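{- Let $d_1,d_2,d_3$ be pairwise distinct elements of $\{1,\dots,\lfloor u/2\rfloor\}\setminus\{\frac u2\}$ such that $d_3=d_2-d_1$ or $d_1+d_2+d_3=u$. Then the graph $\langle \mathbb Z_u\cup\{\infty_1,\infty_2,\infty_3\},\{d_1,d_2,d_3\}\rangle$ can be decomposed into $3$-suns.
   Context: A $3$-sun is the graph on six vertices $a,b,c,d,e,f$ with edges $\{a,b\},\{b,c\},\{c,a\},\{a,d\},\{b,e\},\{c,f\}$; a decomposition of a graph into $3$-suns is a partition of its edge set into subgraphs isomorphic to a $3$-sun. For a positive integer $u$, $\mathbb Z_u=\{0,1,\dots,u-1\}$ (integers mod $u$), and for distinct $i,j\in\mathbb Z_u$, $|i-j|_u=\min\{|i-j|,u-|i-j|\}$. For a set $H$ disjoint from $\mathbb Z_u$ and a nonempty set $D\subseteq\{1,\dots,\lfloor u/2\rfloor\}$, $\langle \mathbb Z_u\cup H,D\rangle$ is the graph with vertex set $\mathbb Z_u\cup H$ and edge set $\{\{i,j\}: i,j\in\mathbb Z_u,\ |i-j|_u\in D\}\cup\{\{\infty,i\}:\infty\in H,\ i\in\mathbb Z_u\}$. -}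

module Defs where

open import Data.Nat using (ℕ; _⊓_; _∸_; ∣_-_∣)
open import Data.Fin using (Fin; toℕ)
open import Data.Sum using (_⊎_; inj₁; inj₂)
open import Data.Product using (_×_; _,_)
open import Data.List using (List; []; _∷_; concatMap; length; lookup)
open import Data.List.Relation.Unary.Any using (Any)
open import Data.Unit using (⊤)
open import Data.Empty using (⊥)
open import Relation.Binary.PropositionalEquality using (_≡_; _≢_)

-- Vertex set Z_u ∪ H with H = {∞₀,∞₁,∞₂} (three infinity points)
Vertex : ℕ → Set
Vertex u = Fin u ⊎ Fin 3

cdist : (u : ℕ) → ℕ → ℕ → ℕ
cdist u i j = ∣ i - j ∣ ⊓ (u ∸ ∣ i - j ∣)

Adj : (u : ℕ) → (ℕ → Set) → Vertex u → Vertex u → Set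
Adj u D (inj₁ i) (inj₁ j) = (toℕ i ≢ toℕ j) × D (cdist u (toℕ i) (toℕ j))
Adj u D (inj₁ i) (inj₂ k) = ⊤
Adj u D (inj₂ k) (inj₁ i) = ⊤
Adj u D (inj₂ k) (inj₂ l) = ⊥

D3 : ℕ → ℕ → ℕ → ℕ → Set
D3 d₁ d₂ d₃ x = x ≡ d₁ ⊎ x ≡ d₂ ⊎ x ≡ d₃

record Sun (V : Set) : Set where
  constructor sun
  field
    a b c d e f : V

open Sun public

AllDistinct : {V : Set} → Sun V → Set
AllDistinct s =
  (a s ≢ b s) × (a s ≢ c s) × (a s ≢ d s) × (a s ≢ e s) × (a s ≢ f s) ×
  (b s ≢ c s) × (b s ≢ d s) × (b s ≢ e s) × (b s ≢ f s) ×
  (c s ≢ d s) × (c s ≢ e s) × (c s ≢ f s) ×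
  (d s ≢ e s) × (d s ≢ f s) ×
  (e s ≢ f s)

sunEdges : {V : Set} → Sun V → List (V × V)
sunEdges s = (a s , b s) ∷ (b s , c s) ∷ (c s , a s) ∷ (a s , d s) ∷ (b s , e s) ∷ (c s , f s) ∷ []

SameEdge : {V : Set} → V × V → V × V → Set
SameEdge (x , y) (x' , y') = (x ≡ x' × y ≡ y') ⊎ (x ≡ y' × y ≡ x')

record SunDecomposition (V : Set) (A : V → V → Set) : Set where
  field
    suns     : List (Sun V)
    distinct : ∀ {s} → Any (λ t → t ≡ s) suns → AllDistinct s
    inGraph  : ∀ {x y} → Any (λ e → e ≡ (x , y)) (concatMap sunEdges suns) → A x y
    covers   : ∀ x y → A x y → Any (SameEdge (x , y)) (concatMap sunEdges suns)
    disjoint : (i j : Data.Fin.Fin (length (concatMap sunEdges suns))) →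
               SameEdge (lookup (concatMap sunEdges suns) i) (lookup (concatMap sunEdges suns) j) →
               i ≡ j

module Submission where

-- Develop the base sun with triangle {0, p, p + r} and pendant vertices ∞₀, ∞₁, ∞₂ modulo u:
-- the k-th sun has triangle k, k + p, k + p + r and pendant edges {k, ∞₀}, {k + p, ∞₁},
-- {k + p + r, ∞₂}. The triangle sides have cyclic lengths p, r and t, the last because
-- t = p + r or t = u − (p + r). Since 2d ≠ u, the edges of length d are exactly the u pairs
-- {x, x + d}, so as k runs over ℤ_u every edge is used exactly once. The first case takes
-- (p, r, t) = (d₁, d₃, d₂), the second (d₁, d₂, d₃). Disjointness holds because an edge, in
-- either orientation, determines the position 6k + j at which it is listed: its length gives j,
-- and whether y − x equals the length or its negative (these differ as 2d ≠ u) gives k.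

open import Defs
open import Data.Bool using (if_then_else_)
open import Data.Empty using (⊥-elim)
open import Data.Fin using (Fin; toℕ) renaming (zero to fzero; suc to fsuc)
open import Data.Fin.Properties using (toℕ-injective; toℕ-fromℕ<; toℕ<n)
open import Data.List using (List; []; _∷_; concatMap; lookup; applyUpTo)
open import Data.List.Relation.Unary.Any using (Any; here; there)
import Data.List.Relation.Unary.Any as Any
open import Data.List.Relation.Unary.Any.Properties using (concatMap⁺; concatMap⁻; applyUpTo⁺; applyUpTo⁻)
open import Data.Nat using (ℕ; zero; suc; _+_; _*_; _∸_; _/_; _≤_; _<_; _⊓_; ∣_-_∣; _%_; _≟_; NonZero; >-nonZero⁻¹; z<s; s<s)
open import Data.Nat.DivMod using (_mod_; %-distribˡ-+; m%n%n≡m%n; [m+n]%n≡m%n; m<n⇒m%n≡m; m%n<n; m%n≤n; m/n*n≤m)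
open import Data.Nat.Properties
open import Data.Product using (_×_; _,_; swap)
open import Data.Sum using (_⊎_; inj₁; inj₂; [_,_]′)
open import Data.Sum.Properties using (inj₁-injective)
open import Data.Unit using (tt)
open import Function using (_∘_)
open import Relation.Binary.PropositionalEquality using (_≡_; _≢_; refl; sym; trans; cong; cong₂; subst; subst₂; module ≡-Reasoning)
open import Relation.Nullary using (does)
open import Relation.Nullary.Decidable using (dec-true; dec-false)

if-≟-≡ : ∀ {A : Set} {m n} {x y : A} → m ≡ n → (if does (m ≟ n) then x else y) ≡ x
if-≟-≡ {m = m} {n} m≡n rewrite dec-true (m ≟ n) m≡n = refl

if-≟-≢ : ∀ {A : Set} {m n} {x y : A} → m ≢ n → (if does (m ≟ n) then x else y) ≡ y
if-≟-≢ {m = m} {n} m≢n rewrite dec-false (m ≟ n) m≢n = refl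

module Cyclic (N : ℕ) .{{_ : NonZero N}} where

  [m%n+k]%n≡[m+k]%n : ∀ m k → (m % N + k) % N ≡ (m + k) % N
  [m%n+k]%n≡[m+k]%n m k = begin
    (m % N + k) % N           ≡⟨ %-distribˡ-+ (m % N) k N ⟩
    (m % N % N + k % N) % N   ≡⟨ cong (λ x → (x + k % N) % N) (m%n%n≡m%n m N) ⟩
    (m % N + k % N) % N       ≡⟨ %-distribˡ-+ m k N ⟨
    (m + k) % N               ∎
    where open ≡-Reasoning

  -- y − x in ℤ_N, provided x ≤ N (otherwise the truncated subtraction gives junk)
  infixl 6 _⊖_
  _⊖_ : ℕ → ℕ → ℕ
  y ⊖ x = (y + (N ∸ x)) % N

  ⊖-intro : ∀ {x y z} → x ≤ N → z < N → (x + z) % N ≡ y % N → y ⊖ x ≡ z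
  ⊖-intro {x} {y} {z} x≤N z<N eq = begin
    (y + (N ∸ x)) % N            ≡⟨ [m%n+k]%n≡[m+k]%n y (N ∸ x) ⟨
    (y % N + (N ∸ x)) % N        ≡⟨ cong (λ w → (w + (N ∸ x)) % N) eq ⟨
    ((x + z) % N + (N ∸ x)) % N  ≡⟨ [m%n+k]%n≡[m+k]%n (x + z) (N ∸ x) ⟩
    (x + z + (N ∸ x)) % N        ≡⟨ cong (_% N) shuffle ⟩
    (z + N) % N                  ≡⟨ [m+n]%n≡m%n z N ⟩
    z % N                        ≡⟨ m<n⇒m%n≡m z<N ⟩
    z                            ∎
    where
    open ≡-Reasoning
    shuffle : x + z + (N ∸ x) ≡ z + N
    shuffle = begin
      x + z + (N ∸ x)   ≡⟨ cong (_+ (N ∸ x)) (+-comm x z) ⟩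
      z + x + (N ∸ x)   ≡⟨ +-assoc z x (N ∸ x) ⟩
      z + (x + (N ∸ x)) ≡⟨ cong (z +_) (m+[n∸m]≡n x≤N) ⟩
      z + N             ∎

  ⊖-elim : ∀ {x y d} → x ≤ N → y < N → y ⊖ x ≡ d → y ≡ (x + d) % N
  ⊖-elim {x} {y} x≤N y<N refl = sym (begin
    (x + (y + (N ∸ x)) % N) % N   ≡⟨ cong (_% N) (+-comm x _) ⟩
    ((y + (N ∸ x)) % N + x) % N   ≡⟨ [m%n+k]%n≡[m+k]%n (y + (N ∸ x)) x ⟩
    (y + (N ∸ x) + x) % N         ≡⟨ cong (_% N) (+-assoc y (N ∸ x) x) ⟩
    (y + ((N ∸ x) + x)) % N       ≡⟨ cong (λ w → (y + w) % N) (m∸n+n≡m x≤N) ⟩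
    (y + N) % N                   ≡⟨ [m+n]%n≡m%n y N ⟩
    y % N                         ≡⟨ m<n⇒m%n≡m y<N ⟩
    y                             ∎)
    where open ≡-Reasoning

  ⊖-forward : ∀ a {c} → c < N → (a + c) % N ⊖ a % N ≡ c
  ⊖-forward a {c} c<N = ⊖-intro (m%n≤n a N) c<N
    (trans ([m%n+k]%n≡[m+k]%n a c) (sym (m%n%n≡m%n (a + c) N)))

  ⊖-backward : ∀ a {c} → 1 ≤ c → c ≤ N → a % N ⊖ (a + c) % N ≡ N ∸ c
  ⊖-backward a {c} 1≤c c≤N = ⊖-intro (m%n≤n (a + c) N) (∸-monoʳ-< 1≤c c≤N) (begin
    ((a + c) % N + (N ∸ c)) % N   ≡⟨ [m%n+k]%n≡[m+k]%n (a + c) (N ∸ c) ⟩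
    (a + c + (N ∸ c)) % N         ≡⟨ cong (_% N) (+-assoc a c (N ∸ c)) ⟩
    (a + (c + (N ∸ c))) % N       ≡⟨ cong (λ w → (a + w) % N) (m+[n∸m]≡n c≤N) ⟩
    (a + N) % N                   ≡⟨ [m+n]%n≡m%n a N ⟩
    a % N                         ≡⟨ m%n%n≡m%n a N ⟨
    a % N % N                     ∎)
    where open ≡-Reasoning

  ⊖-cancelʳ : ∀ a {c} → c ≤ N → (a + c) % N ⊖ c ≡ a % N
  ⊖-cancelʳ a {c} c≤N = ⊖-intro c≤N (m%n<n a N) (begin
    (c + a % N) % N   ≡⟨ cong (_% N) (+-comm c (a % N)) ⟩
    (a % N + c) % N   ≡⟨ [m%n+k]%n≡[m+k]%n a c ⟩
    (a + c) % N       ≡⟨ m%n%n≡m%n (a + c) N ⟨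
    (a + c) % N % N   ∎)
    where open ≡-Reasoning

  cdist-comm : ∀ x y → cdist N x y ≡ cdist N y x
  cdist-comm x y = cong (λ e → e ⊓ (N ∸ e)) (∣-∣-comm x y)

  cdist-self : ∀ x → cdist N x x ≡ 0
  cdist-self x rewrite ∣n-n∣≡0 x = refl

  cdist-⊖ : ∀ {x y} → x < N → y < N → cdist N x y ≡ (y ⊖ x) ⊓ (N ∸ (y ⊖ x))
  cdist-⊖ {x} {y} x<N y<N with ≤-<-connex x y
  ... | inj₁ x≤y = begin
    ∣ x - y ∣ ⊓ (N ∸ ∣ x - y ∣)   ≡⟨ cong (λ e → e ⊓ (N ∸ e)) (m≤n⇒∣m-n∣≡n∸m x≤y) ⟩
    (y ∸ x) ⊓ (N ∸ (y ∸ x))       ≡⟨ cong (λ e → e ⊓ (N ∸ e)) y⊖x ⟨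
    (y ⊖ x) ⊓ (N ∸ (y ⊖ x))       ∎
    where
    open ≡-Reasoning
    y⊖x : y ⊖ x ≡ y ∸ x
    y⊖x = ⊖-intro (<⇒≤ x<N) (≤-<-trans (m∸n≤m y x) y<N) (cong (_% N) (m+[n∸m]≡n x≤y))
  ... | inj₂ y<x = begin
    ∣ x - y ∣ ⊓ (N ∸ ∣ x - y ∣)         ≡⟨ cong (λ g → g ⊓ (N ∸ g)) (m≤n⇒∣n-m∣≡n∸m (<⇒≤ y<x)) ⟩
    g ⊓ (N ∸ g)                         ≡⟨ ⊓-comm g (N ∸ g) ⟩
    (N ∸ g) ⊓ g                         ≡⟨ cong ((N ∸ g) ⊓_) (m∸[m∸n]≡n g≤N) ⟨
    (N ∸ g) ⊓ (N ∸ (N ∸ g))             ≡⟨ cong (λ d → d ⊓ (N ∸ d)) y⊖x ⟨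
    (y ⊖ x) ⊓ (N ∸ (y ⊖ x))             ∎
    where
    open ≡-Reasoning
    g : ℕ
    g = x ∸ y
    g≤N : g ≤ N
    g≤N = ≤-trans (m∸n≤m x y) (<⇒≤ x<N)
    y+g≡x : y + g ≡ x
    y+g≡x = m+[n∸m]≡n (<⇒≤ y<x)
    y⊖x : y ⊖ x ≡ N ∸ g
    y⊖x = ⊖-intro (<⇒≤ x<N) (∸-monoʳ-< (m<n⇒0<n∸m y<x) g≤N) (begin
      (x + (N ∸ g)) % N       ≡⟨ cong (λ w → (w + (N ∸ g)) % N) y+g≡x ⟨
      (y + g + (N ∸ g)) % N   ≡⟨ cong (_% N) (+-assoc y g (N ∸ g)) ⟩
      (y + (g + (N ∸ g))) % N ≡⟨ cong (λ w → (y + w) % N) (m+[n∸m]≡n g≤N) ⟩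
      (y + N) % N             ≡⟨ [m+n]%n≡m%n y N ⟩
      y % N                   ∎)

  cdist-forward : ∀ a {δ} → 1 ≤ δ → δ + δ ≤ N → cdist N (a % N) ((a + δ) % N) ≡ δ
  cdist-forward a {δ} 1≤δ 2δ≤N = begin
    cdist N (a % N) ((a + δ) % N)   ≡⟨ cdist-⊖ (m%n<n a N) (m%n<n (a + δ) N) ⟩
    s ⊓ (N ∸ s)                     ≡⟨ cong (λ e → e ⊓ (N ∸ e)) (⊖-forward a δ<N) ⟩
    δ ⊓ (N ∸ δ)                     ≡⟨ m≤n⇒m⊓n≡m δ≤N∸δ ⟩
    δ                               ∎
    where
    open ≡-Reasoning
    s : ℕ
    s = (a + δ) % N ⊖ a % N
    δ<N : δ < N
    δ<N = <-≤-trans (m<m+n δ 1≤δ) 2δ≤N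
    δ≤N∸δ : δ ≤ N ∸ δ
    δ≤N∸δ = +-cancelʳ-≤ δ δ (N ∸ δ) (subst (δ + δ ≤_) (sym (m∸n+n≡m (<⇒≤ δ<N))) 2δ≤N)

  cdist-orient : ∀ {x y δ} → x < N → y < N → 1 ≤ δ → cdist N x y ≡ δ →
                 y ≡ (x + δ) % N ⊎ x ≡ (y + δ) % N
  cdist-orient {x} {y} {δ} x<N y<N 1≤δ dist =
    orient (⊓-sel s (N ∸ s)) (trans (sym (cdist-⊖ x<N y<N)) dist)
    where
    s : ℕ
    s = y ⊖ x
    y≡x+s : y ≡ (x + s) % N
    y≡x+s = ⊖-elim (<⇒≤ x<N) y<N refl
    orient : s ⊓ (N ∸ s) ≡ s ⊎ s ⊓ (N ∸ s) ≡ N ∸ s → s ⊓ (N ∸ s) ≡ δ →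
             y ≡ (x + δ) % N ⊎ x ≡ (y + δ) % N
    orient (inj₁ min≡s) min≡δ = inj₁ (subst (λ w → y ≡ (x + w) % N) (trans (sym min≡s) min≡δ) y≡x+s)
    orient (inj₂ min≡N∸s) min≡δ =
      inj₂ (subst (λ w → x ≡ (y + w) % N) (trans (sym min≡N∸s) min≡δ) (⊖-elim (<⇒≤ y<N) x<N x⊖y))
      where
      s≢0 : s ≢ 0
      s≢0 s≡0 = <⇒≢ 1≤δ (sym (trans (sym min≡δ) (cong (λ w → w ⊓ (N ∸ w)) s≡0)))
      x⊖y : x ⊖ y ≡ N ∸ s
      x⊖y = subst₂ (λ u w → u ⊖ w ≡ N ∸ s) (m<n⇒m%n≡m x<N) (sym y≡x+s)
              (⊖-backward x (n≢0⇒n>0 s≢0) (m%n≤n (y + (N ∸ x)) N))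

  +-congʳ-% : ∀ {a b} c → a % N ≡ b % N → (a + c) % N ≡ (b + c) % N
  +-congʳ-% {a} {b} c eq = begin
    (a + c) % N       ≡⟨ [m%n+k]%n≡[m+k]%n a c ⟨
    (a % N + c) % N   ≡⟨ cong (λ w → (w + c) % N) eq ⟩
    (b % N + c) % N   ≡⟨ [m%n+k]%n≡[m+k]%n b c ⟩
    (b + c) % N       ∎
    where open ≡-Reasoning

  [m+[n∸k]+k]%n≡m%n : ∀ a {c} → c ≤ N → (a + (N ∸ c) + c) % N ≡ a % N
  [m+[n∸k]+k]%n≡m%n a {c} c≤N = begin
    (a + (N ∸ c) + c) % N     ≡⟨ cong (_% N) (+-assoc a (N ∸ c) c) ⟩
    (a + ((N ∸ c) + c)) % N   ≡⟨ cong (λ w → (a + w) % N) (m∸n+n≡m c≤N) ⟩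
    (a + N) % N               ≡⟨ [m+n]%n≡m%n a N ⟩
    a % N                     ∎
    where open ≡-Reasoning

  m%n≢[m+k]%n : ∀ a {c} → 1 ≤ c → c < N → a % N ≢ (a + c) % N
  m%n≢[m+k]%n a {c} 1≤c c<N eq = <⇒≢ 1≤c (sym (begin
    c                        ≡⟨ ⊖-forward a c<N ⟨
    (a + c) % N ⊖ a % N      ≡⟨ cong (_⊖ a % N) eq ⟨
    a % N ⊖ a % N            ≡⟨ ⊖-intro (m%n≤n a N) (>-nonZero⁻¹ N) (cong (_% N) (+-identityʳ (a % N))) ⟩
    0                        ∎))
    where open ≡-Reasoning

  n∸m≢m : ∀ {c} → c ≤ N → c + c ≢ N → N ∸ c ≢ c
  n∸m≢m {c} c≤N c+c≢N eq = c+c≢N (trans (cong (_+ c) (sym eq)) (m∸n+n≡m c≤N))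

  source : ℕ → ℕ → ℕ → ℕ
  source c x y = if does (y ⊖ x ≟ c) then x else y

  source-forward : ∀ a {c} → c < N → source c (a % N) ((a + c) % N) ≡ a % N
  source-forward a c<N = if-≟-≡ (⊖-forward a c<N)

  source-backward : ∀ a {c} → 1 ≤ c → c ≤ N → c + c ≢ N → source c ((a + c) % N) (a % N) ≡ a % N
  source-backward a 1≤c c≤N c+c≢N =
    if-≟-≢ (n∸m≢m c≤N c+c≢N ∘ trans (sym (⊖-backward a 1≤c c≤N)))

Adj-map : ∀ {u} {D D′ : ℕ → Set} → (∀ {δ} → D δ → D′ δ) → ∀ {x y} → Adj u D x y → Adj u D′ x y
Adj-map D⊆D′ {inj₁ i} {inj₁ j} (i≢j , Dδ) = i≢j , D⊆D′ Dδ
Adj-map _ {inj₁ _} {inj₂ _} _ = tt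
Adj-map _ {inj₂ _} {inj₁ _} _ = tt
Adj-map _ {inj₂ _} {inj₂ _} ()

SunDecomposition-map : ∀ {V} {A B : V → V → Set} →
  (∀ {x y} → A x y → B x y) → (∀ {x y} → B x y → A x y) →
  SunDecomposition V A → SunDecomposition V B
SunDecomposition-map A⇒B B⇒A dec = record
  { suns     = suns
  ; distinct = distinct
  ; inGraph  = λ e∈ → A⇒B (inGraph e∈)
  ; covers   = λ x y Bxy → covers x y (B⇒A Bxy)
  ; disjoint = disjoint
  }
  where open SunDecomposition dec

SameEdge-swap : ∀ {V : Set} {x y : V} {e} → SameEdge (x , y) e → SameEdge (y , x) e
SameEdge-swap (inj₁ (x≡ , y≡)) = inj₂ (y≡ , x≡)
SameEdge-swap (inj₂ (x≡ , y≡)) = inj₁ (y≡ , x≡)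

module EdgePositions {V : Set} (pos : V × V → ℕ) where

  _at_ : V × V → ℕ → Set
  e at n = pos e ≡ n × pos (swap e) ≡ n

  Positioned : ℕ → List (V × V) → Set
  Positioned o es = ∀ i → lookup es i at (o + toℕ i)

  positioned-[] : ∀ {o} → Positioned o []
  positioned-[] ()

  positioned-∷ : ∀ {o e es} → e at o → Positioned (suc o) es → Positioned o (e ∷ es)
  positioned-∷ {o} e-at _ fzero rewrite +-identityʳ o = e-at
  positioned-∷ {o} _ es-at (fsuc i) rewrite +-suc o (toℕ i) = es-at i

  SunAt : Sun V → ℕ → Set
  SunAt s o = (a s , b s) at o × (b s , c s) at (1 + o) × (c s , a s) at (2 + o) ×
              (a s , d s) at (3 + o) × (b s , e s) at (4 + o) × (c s , f s) at (5 + o)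

  positioned-suns : ∀ n (f : ℕ → Sun V) → (∀ k → k < n → SunAt (f k) (k * 6)) →
                    Positioned 0 (concatMap sunEdges (applyUpTo f n))
  positioned-suns = go 0
    where
    go : ∀ o n (f : ℕ → Sun V) → (∀ k → k < n → SunAt (f k) ((o + k) * 6)) →
         Positioned (o * 6) (concatMap sunEdges (applyUpTo f n))
    go o zero f _ = positioned-[]
    go o (suc n) f f-at with subst (SunAt (f 0)) (cong (_* 6) (+-identityʳ o)) (f-at 0 z<s)
    ... | p₀ , p₁ , p₂ , p₃ , p₄ , p₅ =
      positioned-∷ p₀ (positioned-∷ p₁ (positioned-∷ p₂
        (positioned-∷ p₃ (positioned-∷ p₄ (positioned-∷ p₅ (go (suc o) n (f ∘ suc) rest-at))))))
      where
      rest-at : ∀ k → k < n → SunAt (f (suc k)) ((suc o + k) * 6)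
      rest-at k k<n = subst (SunAt (f (suc k))) (cong (_* 6) (+-suc o k)) (f-at (suc k) (s<s k<n))

  same-edge-at : ∀ {e e′ m n} → e at m → e′ at n → SameEdge e e′ → m ≡ n
  same-edge-at (e≡m , _) (e′≡n , _) (inj₁ (refl , refl)) = trans (sym e≡m) e′≡n
  same-edge-at (e≡m , _) (_ , e′ˢ≡n) (inj₂ (refl , refl)) = trans (sym e≡m) e′ˢ≡n

  positioned⇒disjoint : ∀ {es} → Positioned 0 es →
    ∀ i j → SameEdge (lookup es i) (lookup es j) → i ≡ j
  positioned⇒disjoint es-at i j same = toℕ-injective (same-edge-at (es-at i) (es-at j) same)

module DevelopedBlock (N : ℕ) .{{_ : NonZero N}} (p r t : ℕ)
  (1≤p : 1 ≤ p) (1≤r : 1 ≤ r) (1≤t : 1 ≤ t)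
  (2p<N : p + p < N) (2r<N : r + r < N) (2t<N : t + t < N)
  (p≢r : p ≢ r) (p≢t : p ≢ t) (r≢t : r ≢ t)
  (triangle : t ≡ p + r ⊎ p + r + t ≡ N) where

  open Cyclic N

  q : ℕ
  q = p + r

  D : ℕ → Set
  D = D3 p r t

  <-half : ∀ {c} → 1 ≤ c → c + c < N → c < N
  <-half {c} 1≤c 2c<N = <-trans (m<m+n c 1≤c) 2c<N

  p<N : p < N
  p<N = <-half 1≤p 2p<N

  r<N : r < N
  r<N = <-half 1≤r 2r<N

  t<N : t < N
  t<N = <-half 1≤t 2t<N

  1≤q : 1 ≤ q
  1≤q = ≤-trans 1≤p (m≤m+n p r)

  q<N : q < N
  q<N = [ (λ t≡q → subst (_< N) t≡q t<N) , (λ q+t≡N → subst (q <_) q+t≡N (m<m+n q 1≤t)) ]′ triangle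

  2q≢N : q + q ≢ N
  2q≢N = [ (λ t≡q → <⇒≢ (subst (λ w → w + w < N) t≡q 2t<N)) , q+t≡N⇒2q≢N ]′ triangle
    where
    q+t≡N⇒2q≢N : q + t ≡ N → q + q ≢ N
    q+t≡N⇒2q≢N q+t≡N 2q≡N = <⇒≢ 2t<N (trans (cong (_+ t) (sym q≡t)) q+t≡N)
      where
      q≡t : q ≡ t
      q≡t = +-cancelˡ-≡ q q t (trans 2q≡N (sym q+t≡N))

  v : ℕ → Vertex N
  v x = inj₁ (x mod N)

  ∞₀ ∞₁ ∞₂ : Vertex N
  ∞₀ = inj₂ fzero
  ∞₁ = inj₂ (fsuc fzero)
  ∞₂ = inj₂ (fsuc (fsuc fzero))

  S : ℕ → Sun (Vertex N)
  S k = sun (v k) (v (k + p)) (v (k + q)) ∞₀ ∞₁ ∞₂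

  suns : List (Sun (Vertex N))
  suns = applyUpTo S N

  edges : List (Vertex N × Vertex N)
  edges = concatMap sunEdges suns

  toℕ-v : ∀ x → toℕ (x mod N) ≡ x % N
  toℕ-v x = toℕ-fromℕ< (m%n<n x N)

  v-cong : ∀ {x y} → x % N ≡ y % N → v x ≡ v y
  v-cong {x} {y} eq = cong inj₁ (toℕ-injective (trans (toℕ-v x) (trans eq (sym (toℕ-v y)))))

  v≡inj₁ : ∀ {x} (i : Fin N) → toℕ i ≡ x % N → v x ≡ inj₁ i
  v≡inj₁ {x} i eq = cong inj₁ (toℕ-injective (trans (toℕ-v x) (sym eq)))

  v-toℕ : (i : Fin N) → v (toℕ i) ≡ inj₁ i
  v-toℕ i = v≡inj₁ i (sym (m<n⇒m%n≡m (toℕ<n i)))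

  v≢v+ : ∀ a {c} → 1 ≤ c → c < N → v a ≢ v (a + c)
  v≢v+ a 1≤c c<N eq = m%n≢[m+k]%n a 1≤c c<N
    (trans (sym (toℕ-v a)) (trans (cong toℕ (inj₁-injective eq)) (toℕ-v _)))

  S-cong : ∀ {k k′} → k % N ≡ k′ % N → S k ≡ S k′
  S-cong {k} {k′} eq
    rewrite v-cong eq | v-cong (+-congʳ-% p eq) | v-cong (+-congʳ-% q eq) = refl

  S-distinct : ∀ k → AllDistinct (S k)
  S-distinct k =
    v≢v+ k 1≤p p<N , v≢v+ k 1≤q q<N , (λ ()) , (λ ()) , (λ ()) ,
    b≢c , (λ ()) , (λ ()) , (λ ()) ,
    (λ ()) , (λ ()) , (λ ()) ,
    (λ ()) , (λ ()) ,
    (λ ())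
    where
    b≢c : v (k + p) ≢ v (k + q)
    b≢c = subst (λ w → v (k + p) ≢ v w) (+-assoc k p r) (v≢v+ (k + p) 1≤r r<N)

  D⇒1≤ : ∀ {δ} → D δ → 1 ≤ δ
  D⇒1≤ (inj₁ refl)        = 1≤p
  D⇒1≤ (inj₂ (inj₁ refl)) = 1≤r
  D⇒1≤ (inj₂ (inj₂ refl)) = 1≤t

  Adj-v : ∀ {x y δ} → D δ → cdist N (x % N) (y % N) ≡ δ → Adj N D (v x) (v y)
  Adj-v {x} {y} Dδ dist rewrite toℕ-v x | toℕ-v y = x≢y , subst D (sym dist) Dδ
    where
    x≢y : x % N ≢ y % N
    x≢y eq = <⇒≢ (D⇒1≤ Dδ)
      (trans (sym (cdist-self (y % N))) (trans (cong (λ w → cdist N w (y % N)) (sym eq)) dist))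

  dist-ab : ∀ k → cdist N (k % N) ((k + p) % N) ≡ p
  dist-ab k = cdist-forward k 1≤p (<⇒≤ 2p<N)

  dist-bc : ∀ k → cdist N ((k + p) % N) ((k + q) % N) ≡ r
  dist-bc k = subst (λ w → cdist N ((k + p) % N) (w % N) ≡ r) (+-assoc k p r)
                (cdist-forward (k + p) 1≤r (<⇒≤ 2r<N))

  dist-ca : ∀ k → cdist N ((k + q) % N) (k % N) ≡ t
  dist-ca k = [ case-t≡q , case-q+t≡N ]′ triangle
    where
    case-t≡q : t ≡ q → cdist N ((k + q) % N) (k % N) ≡ t
    case-t≡q t≡q = trans (cdist-comm ((k + q) % N) (k % N))
      (trans (cdist-forward k 1≤q (subst (λ w → w + w ≤ N) t≡q (<⇒≤ 2t<N))) (sym t≡q))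
    case-q+t≡N : q + t ≡ N → cdist N ((k + q) % N) (k % N) ≡ t
    case-q+t≡N q+t≡N = subst (λ w → cdist N ((k + q) % N) w ≡ t) k+q+t≡k
                         (cdist-forward (k + q) 1≤t (<⇒≤ 2t<N))
      where
      k+q+t≡k : (k + q + t) % N ≡ k % N
      k+q+t≡k = trans (cong (_% N) (trans (+-assoc k q t) (cong (k +_) q+t≡N))) ([m+n]%n≡m%n k N)

  S-adj : ∀ k {x y} → Any (_≡ (x , y)) (sunEdges (S k)) → Adj N D x y
  S-adj k (here refl)                                         = Adj-v (inj₁ refl) (dist-ab k)
  S-adj k (there (here refl))                                 = Adj-v (inj₂ (inj₁ refl)) (dist-bc k)
  S-adj k (there (there (here refl)))                         = Adj-v (inj₂ (inj₂ refl)) (dist-ca k)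
  S-adj k (there (there (there (here refl))))                 = tt
  S-adj k (there (there (there (there (here refl)))))         = tt
  S-adj k (there (there (there (there (there (here refl)))))) = tt

  edges-adj : ∀ {x y} → Any (_≡ (x , y)) edges → Adj N D x y
  edges-adj e∈ with applyUpTo⁻ S {N} (concatMap⁻ sunEdges e∈)
  ... | k , _ , e∈S = S-adj k e∈S

  suns-distinct : ∀ {s} → Any (_≡ s) suns → AllDistinct s
  suns-distinct s∈ with applyUpTo⁻ S {N} s∈
  ... | k , _ , refl = S-distinct k

  in-edges : ∀ k {P : Vertex N × Vertex N → Set} → Any P (sunEdges (S k)) → Any P edges
  in-edges k {P} e∈S = concatMap⁺ sunEdges
    (applyUpTo⁺ S (subst (Any P ∘ sunEdges) (S-cong (sym (m%n%n≡m%n k N))) e∈S) (m%n<n k N))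

  cover-diff : ∀ x {δ} → D δ → Any (SameEdge (v x , v (x + δ))) edges
  cover-diff x (inj₁ refl) = in-edges x (here (inj₁ (refl , refl)))
  cover-diff x (inj₂ (inj₁ refl)) = in-edges k (there (here (inj₁ (v-cong x≡k+p , v-cong x+r≡k+q))))
    where
    k : ℕ
    k = x + (N ∸ p)
    x≡k+p : x % N ≡ (k + p) % N
    x≡k+p = sym ([m+[n∸k]+k]%n≡m%n x (<⇒≤ p<N))
    x+r≡k+q : (x + r) % N ≡ (k + q) % N
    x+r≡k+q = trans (+-congʳ-% r x≡k+p) (cong (_% N) (+-assoc k p r))
  cover-diff x (inj₂ (inj₂ refl)) = [ case-t≡q , case-q+t≡N ]′ triangle
    where
    case-t≡q : t ≡ q → Any (SameEdge (v x , v (x + t))) edges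
    case-t≡q t≡q = in-edges x (there (there (here (inj₂ (refl , cong (λ w → v (x + w)) t≡q)))))
    case-q+t≡N : q + t ≡ N → Any (SameEdge (v x , v (x + t))) edges
    case-q+t≡N q+t≡N = in-edges (x + t) (there (there (here (inj₁ (v-cong x≡x+t+q , refl)))))
      where
      x≡x+t+q : x % N ≡ (x + t + q) % N
      x≡x+t+q = sym (trans (cong (_% N) (trans (+-assoc x t q) (cong (x +_) (trans (+-comm t q) q+t≡N))))
                           ([m+n]%n≡m%n x N))

  toℕ-shifted : ∀ (i : Fin N) {c} → c ≤ N → toℕ i ≡ (toℕ i + (N ∸ c) + c) % N
  toℕ-shifted i c≤N = trans (sym (m<n⇒m%n≡m (toℕ<n i))) (sym ([m+[n∸k]+k]%n≡m%n (toℕ i) c≤N))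

  cover-∞ : ∀ i j → Any (SameEdge (inj₁ i , inj₂ j)) edges
  cover-∞ i fzero = in-edges (toℕ i)
    (there (there (there (here (inj₁ (sym (v-toℕ i) , refl))))))
  cover-∞ i (fsuc fzero) = in-edges (toℕ i + (N ∸ p))
    (there (there (there (there (here (inj₁ (sym (v≡inj₁ i (toℕ-shifted i (<⇒≤ p<N))) , refl)))))))
  cover-∞ i (fsuc (fsuc fzero)) = in-edges (toℕ i + (N ∸ q))
    (there (there (there (there (there (here (inj₁ (sym (v≡inj₁ i (toℕ-shifted i (<⇒≤ q<N))) , refl))))))))

  edges-cover : ∀ x y → Adj N D x y → Any (SameEdge (x , y)) edges
  edges-cover (inj₁ i) (inj₁ j) (_ , Dδ) with cdist-orient (toℕ<n i) (toℕ<n j) (D⇒1≤ Dδ) refl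
  ... | inj₁ j≡i+δ = subst₂ (λ x y → Any (SameEdge (x , y)) edges) (v-toℕ i) (v≡inj₁ j j≡i+δ)
                       (cover-diff (toℕ i) Dδ)
  ... | inj₂ i≡j+δ = subst₂ (λ x y → Any (SameEdge (x , y)) edges) (v≡inj₁ i i≡j+δ) (v-toℕ j)
                       (Any.map SameEdge-swap (cover-diff (toℕ j) Dδ))
  edges-cover (inj₁ i) (inj₂ j) _ = cover-∞ i j
  edges-cover (inj₂ j) (inj₁ i) _ = Any.map SameEdge-swap (cover-∞ i j)

  edge-index : ℕ → ℕ → ℕ
  edge-index x y =
    if does (cdist N x y ≟ p) then source p x y * 6
    else if does (cdist N x y ≟ r) then 1 + (source r x y ⊖ p) * 6
    else 2 + source q x y * 6

  spoke-index : ℕ → Fin 3 → ℕ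
  spoke-index x fzero               = 3 + x * 6
  spoke-index x (fsuc fzero)        = 4 + (x ⊖ p) * 6
  spoke-index x (fsuc (fsuc fzero)) = 5 + (x ⊖ q) * 6

  index : Vertex N × Vertex N → ℕ
  index (inj₁ i , inj₁ j) = edge-index (toℕ i) (toℕ j)
  index (inj₁ i , inj₂ j) = spoke-index (toℕ i) j
  index (inj₂ j , inj₁ i) = spoke-index (toℕ i) j
  index (inj₂ _ , inj₂ _) = 0  -- never an edge

  index-v : ∀ x y → index (v x , v y) ≡ edge-index (x % N) (y % N)
  index-v x y = cong₂ edge-index (toℕ-v x) (toℕ-v y)

  edge-index-p : ∀ {x y} → cdist N x y ≡ p → edge-index x y ≡ source p x y * 6
  edge-index-p dist = if-≟-≡ dist

  edge-index-r : ∀ {x y} → cdist N x y ≡ r → edge-index x y ≡ 1 + (source r x y ⊖ p) * 6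
  edge-index-r dist = trans (if-≟-≢ (λ eq → p≢r (trans (sym eq) dist))) (if-≟-≡ dist)

  edge-index-t : ∀ {x y} → cdist N x y ≡ t → edge-index x y ≡ 2 + source q x y * 6
  edge-index-t dist =
    trans (if-≟-≢ (λ eq → p≢t (trans (sym eq) dist))) (if-≟-≢ (λ eq → r≢t (trans (sym eq) dist)))

  open EdgePositions index

  ⊖p-cancel : ∀ k → (k + p) % N ⊖ p ≡ k % N
  ⊖p-cancel k = ⊖-cancelʳ k (<⇒≤ p<N)

  ab-at : ∀ k → (v k , v (k + p)) at (k % N * 6)
  ab-at k = (begin
      index (v k , v (k + p))
        ≡⟨ index-v k (k + p) ⟩
      edge-index (k % N) ((k + p) % N)
        ≡⟨ edge-index-p (dist-ab k) ⟩
      source p (k % N) ((k + p) % N) * 6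
        ≡⟨ cong (_* 6) (source-forward k p<N) ⟩
      k % N * 6 ∎)
    , (begin
      index (v (k + p) , v k)
        ≡⟨ index-v (k + p) k ⟩
      edge-index ((k + p) % N) (k % N)
        ≡⟨ edge-index-p (trans (cdist-comm ((k + p) % N) (k % N)) (dist-ab k)) ⟩
      source p ((k + p) % N) (k % N) * 6
        ≡⟨ cong (_* 6) (source-backward k 1≤p (<⇒≤ p<N) (<⇒≢ 2p<N)) ⟩
      k % N * 6 ∎)
    where open ≡-Reasoning

  bc-at : ∀ k → (v (k + p) , v (k + q)) at (1 + k % N * 6)
  bc-at k = subst (λ w → (v (k + p) , v w) at (1 + k % N * 6)) (+-assoc k p r) ((begin
      index (v (k + p) , v (k + p + r))
        ≡⟨ index-v (k + p) (k + p + r) ⟩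
      edge-index ((k + p) % N) ((k + p + r) % N)
        ≡⟨ edge-index-r dist ⟩
      1 + (source r ((k + p) % N) ((k + p + r) % N) ⊖ p) * 6
        ≡⟨ cong (λ w → 1 + (w ⊖ p) * 6) (source-forward (k + p) r<N) ⟩
      1 + ((k + p) % N ⊖ p) * 6
        ≡⟨ cong (λ w → 1 + w * 6) (⊖p-cancel k) ⟩
      1 + k % N * 6 ∎)
    , (begin
      index (v (k + p + r) , v (k + p))
        ≡⟨ index-v (k + p + r) (k + p) ⟩
      edge-index ((k + p + r) % N) ((k + p) % N)
        ≡⟨ edge-index-r (trans (cdist-comm ((k + p + r) % N) ((k + p) % N)) dist) ⟩
      1 + (source r ((k + p + r) % N) ((k + p) % N) ⊖ p) * 6
        ≡⟨ cong (λ w → 1 + (w ⊖ p) * 6) (source-backward (k + p) 1≤r (<⇒≤ r<N) (<⇒≢ 2r<N)) ⟩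
      1 + ((k + p) % N ⊖ p) * 6
        ≡⟨ cong (λ w → 1 + w * 6) (⊖p-cancel k) ⟩
      1 + k % N * 6 ∎))
    where
    open ≡-Reasoning
    dist : cdist N ((k + p) % N) ((k + p + r) % N) ≡ r
    dist = subst (λ w → cdist N ((k + p) % N) (w % N) ≡ r) (sym (+-assoc k p r)) (dist-bc k)

  ca-at : ∀ k → (v (k + q) , v k) at (2 + k % N * 6)
  ca-at k = (begin
      index (v (k + q) , v k)
        ≡⟨ index-v (k + q) k ⟩
      edge-index ((k + q) % N) (k % N)
        ≡⟨ edge-index-t (dist-ca k) ⟩
      2 + source q ((k + q) % N) (k % N) * 6
        ≡⟨ cong (λ w → 2 + w * 6) (source-backward k 1≤q (<⇒≤ q<N) 2q≢N) ⟩
      2 + k % N * 6 ∎)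
    , (begin
      index (v k , v (k + q))
        ≡⟨ index-v k (k + q) ⟩
      edge-index (k % N) ((k + q) % N)
        ≡⟨ edge-index-t (trans (cdist-comm (k % N) ((k + q) % N)) (dist-ca k)) ⟩
      2 + source q (k % N) ((k + q) % N) * 6
        ≡⟨ cong (λ w → 2 + w * 6) (source-forward k q<N) ⟩
      2 + k % N * 6 ∎)
    where open ≡-Reasoning

  S-at : ∀ k → SunAt (S k) (k % N * 6)
  S-at k = ab-at k , bc-at k , ca-at k , (spoke₀ , spoke₀) , (spoke₁ , spoke₁) , (spoke₂ , spoke₂)
    where
    spoke₀ : 3 + toℕ (k mod N) * 6 ≡ 3 + k % N * 6
    spoke₀ = cong (λ w → 3 + w * 6) (toℕ-v k)
    spoke₁ : 4 + (toℕ ((k + p) mod N) ⊖ p) * 6 ≡ 4 + k % N * 6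
    spoke₁ = trans (cong (λ w → 4 + (w ⊖ p) * 6) (toℕ-v (k + p))) (cong (λ w → 4 + w * 6) (⊖p-cancel k))
    spoke₂ : 5 + (toℕ ((k + q) mod N) ⊖ q) * 6 ≡ 5 + k % N * 6
    spoke₂ = trans (cong (λ w → 5 + (w ⊖ q) * 6) (toℕ-v (k + q)))
                   (cong (λ w → 5 + w * 6) (⊖-cancelʳ k (<⇒≤ q<N)))

  decomposition : SunDecomposition (Vertex N) (Adj N D)
  decomposition = record
    { suns     = suns
    ; distinct = suns-distinct
    ; inGraph  = edges-adj
    ; covers   = edges-cover
    ; disjoint = positioned⇒disjoint {edges} (positioned-suns N S S-at′)
    }
    where
    S-at′ : ∀ k → k < N → SunAt (S k) (k * 6)
    S-at′ k k<N = subst (SunAt (S k)) (cong (_* 6) (m<n⇒m%n≡m k<N)) (S-at k)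

half-bound : ∀ {u d} .{{_ : NonZero u}} → d ≤ u / 2 → 2 * d ≢ u → d + d < u
half-bound {u} {d} d≤u/2 2d≢u = ≤∧≢⇒< d+d≤u (2d≢u ∘ trans (cong (d +_) (+-identityʳ d)))
  where
  d+d≤u : d + d ≤ u
  d+d≤u = begin
    d + d             ≤⟨ +-mono-≤ d≤u/2 d≤u/2 ⟩
    u / 2 + u / 2     ≡⟨ cong (u / 2 +_) (+-identityʳ (u / 2)) ⟨
    2 * (u / 2)       ≡⟨ *-comm 2 (u / 2) ⟩
    u / 2 * 2         ≤⟨ m/n*n≤m u 2 ⟩
    u                 ∎
    where open ≤-Reasoning

D3-swap₂₃ : ∀ {d₁ d₂ d₃ δ} → D3 d₁ d₂ d₃ δ → D3 d₁ d₃ d₂ δ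
D3-swap₂₃ (inj₁ δ≡d₁)        = inj₁ δ≡d₁
D3-swap₂₃ (inj₂ (inj₁ δ≡d₂)) = inj₂ (inj₂ δ≡d₂)
D3-swap₂₃ (inj₂ (inj₂ δ≡d₃)) = inj₂ (inj₁ δ≡d₃)

lemma2p13 : (u d₁ d₂ d₃ : ℕ) →
    1 ≤ d₁ → d₁ ≤ u / 2 → 2 * d₁ ≢ u →
    1 ≤ d₂ → d₂ ≤ u / 2 → 2 * d₂ ≢ u →
    1 ≤ d₃ → d₃ ≤ u / 2 → 2 * d₃ ≢ u →
    d₁ ≢ d₂ → d₁ ≢ d₃ → d₂ ≢ d₃ →
    (d₃ + d₁ ≡ d₂ ⊎ d₁ + d₂ + d₃ ≡ u) →
    SunDecomposition (Vertex u) (Adj u (D3 d₁ d₂ d₃))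
lemma2p13 zero d₁ _ _ 1≤d₁ d₁≤0 _ _ _ _ _ _ _ _ _ _ _ = ⊥-elim (<⇒≱ 1≤d₁ d₁≤0)
lemma2p13 u@(suc _) d₁ d₂ d₃ 1≤d₁ d₁≤ 2d₁≢ 1≤d₂ d₂≤ 2d₂≢ 1≤d₃ d₃≤ 2d₃≢ d₁≢d₂ d₁≢d₃ d₂≢d₃
          (inj₁ d₃+d₁≡d₂) =
  SunDecomposition-map (Adj-map D3-swap₂₃) (Adj-map D3-swap₂₃)
    (DevelopedBlock.decomposition u d₁ d₃ d₂ 1≤d₁ 1≤d₃ 1≤d₂
      (half-bound d₁≤ 2d₁≢) (half-bound d₃≤ 2d₃≢) (half-bound d₂≤ 2d₂≢)
      d₁≢d₃ d₁≢d₂ (d₂≢d₃ ∘ sym) (inj₁ (trans (sym d₃+d₁≡d₂) (+-comm d₃ d₁))))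
lemma2p13 u@(suc _) d₁ d₂ d₃ 1≤d₁ d₁≤ 2d₁≢ 1≤d₂ d₂≤ 2d₂≢ 1≤d₃ d₃≤ 2d₃≢ d₁≢d₂ d₁≢d₃ d₂≢d₃
          (inj₂ sum≡u) =
  DevelopedBlock.decomposition u d₁ d₂ d₃ 1≤d₁ 1≤d₂ 1≤d₃
    (half-bound d₁≤ 2d₁≢) (half-bound d₂≤ 2d₂≢) (half-bound d₃≤ 2d₃≢)
    d₁≢d₂ d₁≢d₃ d₂≢d₃ (inj₂ sum≡u)
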